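{- Let $G=(A,B,E)$ be a bipartite graph with $|A|=|B|$ having a perfect matching $M^*$, fix an arrival order of the $A$-vertices and an integer $k\ge1$. Choose a category function $c:B\to\{1,\dots,2^k\}$ by assigning each $b\in B$ a category independently and uniformly at random, let $M=\textsc{Ranking}(\sigma_c)$, and let $b$ be a uniformly random vertex of $B$ (independent of $c$). Then for every $i\in\{1,\dots,2^k\}$, $$\Pr\big[b\notin V(M)\text{ and }M^*(b)\text{ is matched in }M\text{ to some }b'\text{ with }c(b')\le i\;\big|\;c(b)=i\big]\le \Pr\big[M^*(b)\text{ is matched in }M\text{ to some }b'\text{ with }c(b')\le i\big].$$
   Context: Given $B=[m]$ and a category function $c:B\to\{1,\dots,2^k\}$, $\sigma_c$ is the unique permutation of $B$ such that $\sigma_c(b_1)<\sigma_c(b_2)$ iff $c(b_1)<c(b_2)$, or $c(b_1)=c(b_2)$ and $b_1<b_2$. $\textsc{Ranking}(\sigma)$ denotes the matching produced when the $A$-vertices arrive one by one in the fixed arrival order and each arriving vertex $a$ is matched to its unmatched neighbour $b$ of minimum rank $\sigma(b)$ (left unmatched if none exists). $V(M)$ is the set of vertices covered by $M$, and $M^*(b)$ is the partner of $b$ in $M^*$. -}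

module Defs where

open import Data.Nat using (ℕ; zero; suc; _+_; _*_; _^_; _<ᵇ_; _≤ᵇ_)
open import Data.Fin using (Fin; toℕ) renaming (zero to fzero; suc to fsuc)
import Data.Fin as F
open import Data.List using (List; []; _∷_; map; concatMap; foldl; allFin; cartesianProduct)
open import Data.Bool using (Bool; true; false; _∧_; _∨_; not; if_then_else_)
open import Data.Maybe using (Maybe; just; nothing)
open import Data.Product using (_×_; _,_)
open import Relation.Nullary using (does)

-- Vertex sets: A = Fin m, B = Fin m.  E a b = true iff (a , b) is an edge.
Graph : ℕ → Set
Graph m = Fin m → Fin m → Bool

-- Category function c : B → {1,…,2^k}; category j+1 is represented by j : Fin (2^k).
Cat : ℕ → ℕ → Set
Cat m k = Fin m → Fin (2 ^ k)

count : {X : Set} → (X → Bool) → List X → ℕ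
count p [] = 0
count p (x ∷ xs) = if p x then suc (count p xs) else count p xs

filterᵇ : {X : Set} → (X → Bool) → List X → List X
filterᵇ p [] = []
filterᵇ p (x ∷ xs) = if p x then x ∷ filterᵇ p xs else filterᵇ p xs

anyᵇ : {X : Set} → (X → Bool) → List X → Bool
anyᵇ p [] = false
anyᵇ p (x ∷ xs) = p x ∨ anyᵇ p xs

_=ᶠ_ : {n : ℕ} → Fin n → Fin n → Bool
x =ᶠ y = does (x F.≟ y)

-- list of all functions Fin m → Fin K (each exactly once, up to pointwise equality)
consF : {m K : ℕ} → Fin K → (Fin m → Fin K) → Fin (suc m) → Fin K
consF x f fzero = x
consF x f (fsuc j) = f j

allFuns : (m K : ℕ) → List (Fin m → Fin K)
allFuns zero K = (λ ()) ∷ []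
allFuns (suc m) K = concatMap (λ f → map (λ x → consF x f) (allFin K)) (allFuns m K)

-- σ_c(b) (0-based): number of b' that precede b in the order
-- (c(b'),b') <lex (c(b),b).  This is the unique permutation of the paper.
σ : {m : ℕ} (k : ℕ) → Cat m k → Fin m → ℕ
σ {m} k c b = count (λ b' → (toℕ (c b') <ᵇ toℕ (c b))
                          ∨ ((c b' =ᶠ c b) ∧ (toℕ b' <ᵇ toℕ b))) (allFin m)

-- A matching state: for each b ∈ B, its partner in A (if any).
Matching : ℕ → Set
Matching m = Fin m → Maybe (Fin m)

pickMin : {m : ℕ} → (Fin m → ℕ) → List (Fin m) → Maybe (Fin m)
pickMin r [] = nothing
pickMin r (b ∷ bs) with pickMin r bs
... | nothing = just b
... | just b' = if r b ≤ᵇ r b' then just b else just b'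

isNothingᵇ : {X : Set} → Maybe X → Bool
isNothingᵇ nothing = true
isNothingᵇ (just _) = false

step : {m : ℕ} → Graph m → (Fin m → ℕ) → Matching m → Fin m → Matching m
step {m} E r M a with pickMin r (filterᵇ (λ b → E a b ∧ isNothingᵇ (M b)) (allFin m))
... | nothing = M
... | just b = λ b'' → if b'' =ᶠ b then just a else M b''

Ranking : {m : ℕ} → Graph m → (Fin m → Fin m) → (Fin m → ℕ) → Matching m
Ranking {m} E ord r = foldl (step E r) (λ _ → nothing) (map ord (allFin m))

unmatchedB : {m : ℕ} → Matching m → Fin m → Bool
unmatchedB M b = isNothingᵇ (M b)

matchedTo : {m : ℕ} → Maybe (Fin m) → Fin m → Bool
matchedTo nothing a = false
matchedTo (just a') a = a' =ᶠ a

matchedLow : {m : ℕ} (k : ℕ) → Matching m → Cat m k → Fin (2 ^ k) → Fin m → Bool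
matchedLow {m} k M c i a = anyᵇ (λ b' → matchedTo (M b') a ∧ (toℕ (c b') ≤ᵇ toℕ i)) (allFin m)

-- the (uniform) sample space of pairs (c , b)
Ω : (m k : ℕ) → List (Cat m k × Fin m)
Ω m k = cartesianProduct (allFuns m (2 ^ k)) (allFin m)

Mc : {m : ℕ} (k : ℕ) → Graph m → (Fin m → Fin m) → Cat m k → Matching m
Mc k E ord c = Ranking E ord (σ k c)

evCat : {m : ℕ} (k : ℕ) → Fin (2 ^ k) → Cat m k × Fin m → Bool
evCat k i (c , b) = c b =ᶠ i

evLeft : {m : ℕ} (k : ℕ) → Graph m → (Fin m → Fin m) → (Fin m → Fin m) → Fin (2 ^ k) → Cat m k × Fin m → Bool
evLeft k E ord Mstar i (c , b) = unmatchedB (Mc k E ord c) b ∧ matchedLow k (Mc k E ord c) c i (Mstar b)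

evRight : {m : ℕ} (k : ℕ) → Graph m → (Fin m → Fin m) → (Fin m → Fin m) → Fin (2 ^ k) → Cat m k × Fin m → Bool
evRight k E ord Mstar i (c , b) = matchedLow k (Mc k E ord c) c i (Mstar b)

_∩ᵇ_ : {X : Set} → (X → Bool) → (X → Bool) → X → Bool
(p ∩ᵇ q) x = p x ∧ q x

module Submission where

-- Fix b with c(b) = i.  If b is unmatched in M = Ranking(σ_c) and M*(b) is matched to
-- some b' with c(b') ≤ i, then changing c(b) to ANY value x keeps M*(b) matched to a vertex of
-- category ≤ i: the change moves only b in the order σ, and a comparison of the two runs of
-- Ranking (as long as b stays unmatched in the first run, every vertex matched there is matched in
-- the second run to a vertex of no larger rank) shows that M*(b) is matched to some b'' with
-- σ_c'(b'') ≤ σ_c'(b'), whence c'(b'') ≤ c'(b') = c(b') ≤ i.  Counting over the uniform sample space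
-- of pairs (c , b), each outcome of {c(b) = i} ∩ L thus yields 2^k outcomes of R, so
-- 2^k · #({c(b) = i} ∩ L) ≤ #R, while |Ω| = 2^k · #{c(b) = i}; together these give the statement.

open import Defs
open import Data.Nat using (ℕ; zero; suc; _+_; _*_; _≤_; _<_; _^_; z≤n; s≤s; _<ᵇ_; _≤ᵇ_)
open import Data.Nat.Properties
open import Algebra.Properties.CommutativeSemigroup +-commutativeSemigroup using (interchange)
open import Data.Fin using (Fin; toℕ) renaming (zero to fzero; suc to fsuc)
import Data.Fin as F
open import Data.Fin.Properties using (toℕ-injective)
open import Data.List using (List; []; _∷_; map; concatMap; foldl; allFin; cartesianProduct; length; _++_)
open import Data.List.Properties using (map-tabulate; length-tabulate)
open import Data.List.Membership.Propositional using (_∈_)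
open import Data.List.Membership.Propositional.Properties using (∈-allFin)
open import Data.List.Relation.Unary.Any using (here; there)
open import Data.Bool using (Bool; true; false; _∧_; _∨_; if_then_else_; T)
open import Data.Bool.Properties using (∧-identityʳ; T-∧; T-∨)
open import Data.Maybe using (Maybe; just; nothing)
open import Data.Maybe.Properties using (just-injective)
open import Data.Product using (_×_; _,_; proj₁; proj₂; Σ)
open import Data.Sum using (_⊎_; inj₁; inj₂)
open import Data.Empty using (⊥-elim)
open import Data.Unit using (tt)
open import Relation.Nullary using (¬_; yes; no)
open import Relation.Nullary.Decidable using (dec-true)
open import Relation.Binary using (tri<; tri≈; tri>)
open import Relation.Binary.PropositionalEquality
open import Function using (_∘_; id)
open import Function.Bundles using (Equivalence)
open import Function.Definitions using (Injective)

-- Finite sums and counting.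

sumOver : {X : Set} → (X → ℕ) → List X → ℕ
sumOver f [] = 0
sumOver f (x ∷ xs) = f x + sumOver f xs

syntax sumOver (λ x → e) L = ∑[ x ∈ L ] e

module _ {X : Set} where

  sum-cong : {f g : X → ℕ} (L : List X) → (∀ x → f x ≡ g x) → sumOver f L ≡ sumOver g L
  sum-cong [] f≗g = refl
  sum-cong (x ∷ L) f≗g = cong₂ _+_ (f≗g x) (sum-cong L f≗g)

  sum-mono : {f g : X → ℕ} (L : List X) → (∀ x → f x ≤ g x) → sumOver f L ≤ sumOver g L
  sum-mono [] f≤g = z≤n
  sum-mono (x ∷ L) f≤g = +-mono-≤ (f≤g x) (sum-mono L f≤g)

  sum-zero : (L : List X) → ∑[ x ∈ L ] 0 ≡ 0
  sum-zero [] = refl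
  sum-zero (x ∷ L) = sum-zero L

  sum-+ : (f g : X → ℕ) (L : List X) → ∑[ x ∈ L ] (f x + g x) ≡ sumOver f L + sumOver g L
  sum-+ f g [] = refl
  sum-+ f g (x ∷ L) =
    trans (cong (f x + g x +_) (sum-+ f g L)) (interchange (f x) (g x) (sumOver f L) (sumOver g L))

  sum-const : (c : ℕ) (L : List X) → ∑[ x ∈ L ] c ≡ length L * c
  sum-const c [] = refl
  sum-const c (x ∷ L) = cong (c +_) (sum-const c L)

  sum-scale : (c : ℕ) (f : X → ℕ) (L : List X) → ∑[ x ∈ L ] (c * f x) ≡ c * sumOver f L
  sum-scale c f [] = sym (*-zeroʳ c)
  sum-scale c f (x ∷ L) = trans (cong (c * f x +_) (sum-scale c f L)) (sym (*-distribˡ-+ c (f x) _))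

sum-swap : {X Y : Set} (h : X → Y → ℕ) (xs : List X) (ys : List Y) →
  ∑[ x ∈ xs ] ∑[ y ∈ ys ] h x y ≡ ∑[ y ∈ ys ] ∑[ x ∈ xs ] h x y
sum-swap h [] ys = sym (sum-zero ys)
sum-swap h (x ∷ xs) ys = trans (cong (sumOver (h x) ys +_) (sum-swap h xs ys))
  (sym (sum-+ (h x) (λ y → ∑[ x' ∈ xs ] h x' y) ys))

sum-map : {X Y : Set} (f : Y → ℕ) (h : X → Y) (xs : List X) → sumOver f (map h xs) ≡ ∑[ x ∈ xs ] f (h x)
sum-map f h [] = refl
sum-map f h (x ∷ xs) = cong (f (h x) +_) (sum-map f h xs)

sum-allFin-suc : (K : ℕ) (f : Fin (suc K) → ℕ) → sumOver f (allFin (suc K)) ≡ f fzero + ∑[ x ∈ allFin K ] f (fsuc x)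
sum-allFin-suc K f = cong (f fzero +_) (trans (cong (sumOver f) (sym (map-tabulate id fsuc))) (sum-map f fsuc (allFin K)))

length-allFin : (K : ℕ) → length (allFin K) ≡ K
length-allFin K = length-tabulate {n = K} id

sum-delta : (K : ℕ) (i : Fin K) (a : Fin K → ℕ) → ∑[ x ∈ allFin K ] (if x =ᶠ i then a x else 0) ≡ a i
sum-delta (suc K) fzero a =
  trans (sum-allFin-suc K (λ x → if x =ᶠ fzero then a x else 0))
    (trans (cong (a fzero +_) (sum-zero (allFin K))) (+-identityʳ (a fzero)))
sum-delta (suc K) (fsuc i) a =
  trans (sum-allFin-suc K (λ x → if x =ᶠ fsuc i then a x else 0)) (sum-delta K i (a ∘ fsuc))

⌊_⌋ : Bool → ℕ
⌊ true ⌋ = 1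
⌊ false ⌋ = 0

module _ {X : Set} where

  count-as-sum : (p : X → Bool) (L : List X) → count p L ≡ ∑[ x ∈ L ] ⌊ p x ⌋
  count-as-sum p [] = refl
  count-as-sum p (x ∷ L) with p x
  ... | true = cong suc (count-as-sum p L)
  ... | false = count-as-sum p L

  count-++ : (p : X → Bool) (xs ys : List X) → count p (xs ++ ys) ≡ count p xs + count p ys
  count-++ p [] ys = refl
  count-++ p (x ∷ xs) ys with p x
  ... | true = cong suc (count-++ p xs ys)
  ... | false = count-++ p xs ys

  count-map : {Y : Set} (p : Y → Bool) (f : X → Y) (xs : List X) → count p (map f xs) ≡ count (p ∘ f) xs
  count-map p f [] = refl
  count-map p f (x ∷ xs) with p (f x)
  ... | true = cong suc (count-map p f xs)
  ... | false = count-map p f xs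

  count-cong : {p q : X → Bool} (L : List X) → (∀ x → p x ≡ q x) → count p L ≡ count q L
  count-cong {p} {q} L p≗q = trans (count-as-sum p L) (trans (sum-cong L (cong ⌊_⌋ ∘ p≗q)) (sym (count-as-sum q L)))

  count-false : (L : List X) → count (λ _ → false) L ≡ 0
  count-false [] = refl
  count-false (x ∷ L) = count-false L

  length-as-count : (L : List X) → length L ≡ count (λ _ → true) L
  length-as-count [] = refl
  length-as-count (x ∷ L) = cong suc (length-as-count L)

  count-mono : (p q : X → Bool) (L : List X) → (∀ x → T (p x) → T (q x)) → count p L ≤ count q L
  count-mono p q [] p⇒q = z≤n
  count-mono p q (x ∷ L) p⇒q with p x in px | q x in qx
  ... | true | true = s≤s (count-mono p q L p⇒q)
  ... | true | false = ⊥-elim (subst T qx (p⇒q x (subst T (sym px) tt)))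
  ... | false | true = m≤n⇒m≤1+n (count-mono p q L p⇒q)
  ... | false | false = count-mono p q L p⇒q

  count-< : (p q : X → Bool) (L : List X) → (∀ x → T (p x) → T (q x)) →
    (w : X) → w ∈ L → T (q w) → ¬ T (p w) → count p L < count q L
  count-< p q (x ∷ L) p⇒q w w∈L qw ¬pw with p x in px | q x in qx | w∈L
  ... | true | false | _ = ⊥-elim (subst T qx (p⇒q x (subst T (sym px) tt)))
  ... | true | true | here refl = ⊥-elim (¬pw (subst T (sym px) tt))
  ... | true | true | there w∈L' = s≤s (count-< p q L p⇒q w w∈L' qw ¬pw)
  ... | false | true | _ = s≤s (count-mono p q L p⇒q)
  ... | false | false | here refl = ⊥-elim (subst T qx qw)
  ... | false | false | there w∈L' = count-< p q L p⇒q w w∈L' qw ¬pw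

count-swap : {X Y : Set} (p : X → Y → Bool) (xs : List X) (ys : List Y) →
  ∑[ x ∈ xs ] count (p x) ys ≡ ∑[ y ∈ ys ] count (λ x → p x y) xs
count-swap p xs ys = begin
    ∑[ x ∈ xs ] count (p x) ys
  ≡⟨ sum-cong xs (λ x → count-as-sum (p x) ys) ⟩
    ∑[ x ∈ xs ] ∑[ y ∈ ys ] ⌊ p x y ⌋
  ≡⟨ sum-swap (λ x y → ⌊ p x y ⌋) xs ys ⟩
    ∑[ y ∈ ys ] ∑[ x ∈ xs ] ⌊ p x y ⌋
  ≡⟨ sum-cong ys (λ y → sym (count-as-sum (λ x → p x y) xs)) ⟩
    ∑[ y ∈ ys ] count (λ x → p x y) xs
  ∎
  where open ≡-Reasoning

count-concatMap : {X Y : Set} (p : Y → Bool) (f : X → List Y) (L : List X) →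
  count p (concatMap f L) ≡ ∑[ x ∈ L ] count p (f x)
count-concatMap p f [] = refl
count-concatMap p f (x ∷ L) = trans (count-++ p (f x) (concatMap f L)) (cong (count p (f x) +_) (count-concatMap p f L))

count-cartesian : {X Y : Set} (p : X × Y → Bool) (xs : List X) (ys : List Y) →
  count p (cartesianProduct xs ys) ≡ ∑[ x ∈ xs ] count (λ y → p (x , y)) ys
count-cartesian p [] ys = refl
count-cartesian p (x ∷ xs) ys = trans (count-++ p (map (x ,_) ys) (cartesianProduct xs ys))
  (cong₂ _+_ (count-map p (x ,_) ys) (count-cartesian p xs ys))

count-select : {X : Set} (K : ℕ) (i : Fin K) (Q : Fin K → X → Bool) (L : List X) →
  ∑[ x ∈ allFin K ] count (λ g → (x =ᶠ i) ∧ Q x g) L ≡ count (Q i) L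
count-select K i Q L = trans (sum-cong (allFin K) restrict) (sum-delta K i (λ x → count (Q x) L))
  where
  restrict : ∀ x → count (λ g → (x =ᶠ i) ∧ Q x g) L ≡ (if x =ᶠ i then count (Q x) L else 0)
  restrict x with x =ᶠ i
  ... | true = refl
  ... | false = count-false L

-- Every such function is obtained from its value x at a chosen
-- position b and its remaining values g : Fin n → Fin K; counting over allFuns can therefore be
-- organised by the value at any position b.

insertAt : {n K : ℕ} → Fin (suc n) → Fin K → (Fin n → Fin K) → Fin (suc n) → Fin K
insertAt fzero x g = consF x g
insertAt {suc n} (fsuc b) x g = consF (g fzero) (insertAt b x (g ∘ fsuc))

insertAt-here : {n K : ℕ} (b : Fin (suc n)) (x : Fin K) (g : Fin n → Fin K) → insertAt b x g b ≡ x
insertAt-here fzero x g = refl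
insertAt-here {suc n} (fsuc b) x g = insertAt-here b x (g ∘ fsuc)

insertAt-elsewhere : {n K : ℕ} (b : Fin (suc n)) (x x' : Fin K) (g : Fin n → Fin K) (y : Fin (suc n)) →
  ¬ y ≡ b → insertAt b x g y ≡ insertAt b x' g y
insertAt-elsewhere fzero x x' g fzero y≢b = ⊥-elim (y≢b refl)
insertAt-elsewhere fzero x x' g (fsuc y) y≢b = refl
insertAt-elsewhere {suc n} (fsuc b) x x' g fzero y≢b = refl
insertAt-elsewhere {suc n} (fsuc b) x x' g (fsuc y) y≢b = insertAt-elsewhere b x x' (g ∘ fsuc) y (y≢b ∘ cong fsuc)

count-allFuns-head : (n K : ℕ) (P : (Fin (suc n) → Fin K) → Bool) →
  count P (allFuns (suc n) K) ≡ ∑[ x ∈ allFin K ] count (λ g → P (consF x g)) (allFuns n K)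
count-allFuns-head n K P = begin
    count P (allFuns (suc n) K)
  ≡⟨ count-concatMap P (λ g → map (λ x → consF x g) (allFin K)) (allFuns n K) ⟩
    ∑[ g ∈ allFuns n K ] count P (map (λ x → consF x g) (allFin K))
  ≡⟨ sum-cong (allFuns n K) (λ g → count-map P (λ x → consF x g) (allFin K)) ⟩
    ∑[ g ∈ allFuns n K ] count (λ x → P (consF x g)) (allFin K)
  ≡⟨ count-swap (λ g x → P (consF x g)) (allFuns n K) (allFin K) ⟩
    ∑[ x ∈ allFin K ] count (λ g → P (consF x g)) (allFuns n K)
  ∎
  where open ≡-Reasoning

count-allFuns-at : (n K : ℕ) (b : Fin (suc n)) (P : (Fin (suc n) → Fin K) → Bool) →
  count P (allFuns (suc n) K) ≡ ∑[ x ∈ allFin K ] count (λ g → P (insertAt b x g)) (allFuns n K)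
count-allFuns-at n K fzero P = count-allFuns-head n K P
count-allFuns-at (suc n) K (fsuc b) P = begin
    count P (allFuns (suc (suc n)) K)
  ≡⟨ count-allFuns-head (suc n) K P ⟩
    ∑[ y ∈ allFin K ] count (λ f → P (consF y f)) (allFuns (suc n) K)
  ≡⟨ sum-cong (allFin K) (λ y → count-allFuns-at n K b (λ f → P (consF y f))) ⟩
    ∑[ y ∈ allFin K ] ∑[ x ∈ allFin K ] count (λ g → P (consF y (insertAt b x g))) (allFuns n K)
  ≡⟨ sum-swap (λ y x → count (λ g → P (consF y (insertAt b x g))) (allFuns n K)) (allFin K) (allFin K) ⟩
    ∑[ x ∈ allFin K ] ∑[ y ∈ allFin K ] count (λ g → P (consF y (insertAt b x g))) (allFuns n K)
  ≡⟨ sum-cong (allFin K) (λ x → sym (count-allFuns-head n K (λ g → P (insertAt (fsuc b) x g)))) ⟩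
    ∑[ x ∈ allFin K ] count (λ g → P (insertAt (fsuc b) x g)) (allFuns (suc n) K)
  ∎
  where open ≡-Reasoning

-- The uniform sample space of pairs (c , b) with c : Fin m → Fin K; for K = 2 ^ k it is Ω m k.
Space : (m K : ℕ) → List ((Fin m → Fin K) × Fin m)
Space m K = cartesianProduct (allFuns m K) (allFin m)

-- The event c(b) = i; for K = 2 ^ k it is evCat k i.
hasCat : {m K : ℕ} → Fin K → (Fin m → Fin K) × Fin m → Bool
hasCat i (c , b) = c b =ᶠ i

count-Space : (n K : ℕ) (p : (Fin (suc n) → Fin K) × Fin (suc n) → Bool) →
  count p (Space (suc n) K)
    ≡ ∑[ b ∈ allFin (suc n) ] ∑[ x ∈ allFin K ] count (λ g → p (insertAt b x g , b)) (allFuns n K)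
count-Space n K p = begin
    count p (Space (suc n) K)
  ≡⟨ count-cartesian p (allFuns (suc n) K) (allFin (suc n)) ⟩
    ∑[ c ∈ allFuns (suc n) K ] count (λ b → p (c , b)) (allFin (suc n))
  ≡⟨ count-swap (λ c b → p (c , b)) (allFuns (suc n) K) (allFin (suc n)) ⟩
    ∑[ b ∈ allFin (suc n) ] count (λ c → p (c , b)) (allFuns (suc n) K)
  ≡⟨ sum-cong (allFin (suc n)) (λ b → count-allFuns-at n K b (λ c → p (c , b))) ⟩
    ∑[ b ∈ allFin (suc n) ] ∑[ x ∈ allFin K ] count (λ g → p (insertAt b x g , b)) (allFuns n K)
  ∎
  where open ≡-Reasoning

count-hasCat : (n K : ℕ) (i : Fin K) (P : (Fin (suc n) → Fin K) × Fin (suc n) → Bool) →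
  count (hasCat i ∩ᵇ P) (Space (suc n) K) ≡ ∑[ b ∈ allFin (suc n) ] count (λ g → P (insertAt b i g , b)) (allFuns n K)
count-hasCat n K i P = trans (count-Space n K (hasCat i ∩ᵇ P)) (sum-cong (allFin (suc n)) (λ b →
  trans (sum-cong (allFin K) (λ x → count-cong (allFuns n K) (λ g →
          cong (λ y → (y =ᶠ i) ∧ P (insertAt b x g , b)) (insertAt-here b x g))))
        (count-select K i (λ x g → P (insertAt b x g , b)) (allFuns n K))))

length-Space : (m K : ℕ) (i : Fin K) → length (Space m K) ≡ K * count (hasCat i) (Space m K)
length-Space zero K i = sym (*-zeroʳ K)
length-Space (suc n) K i = begin
    length (Space (suc n) K)
  ≡⟨ trans (length-as-count (Space (suc n) K)) (count-Space n K (λ _ → true)) ⟩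
    ∑[ b ∈ allFin (suc n) ] ∑[ x ∈ allFin K ] N
  ≡⟨ sum-cong (allFin (suc n)) (λ b → trans (sum-const N (allFin K)) (cong (_* N) (length-allFin K))) ⟩
    ∑[ b ∈ allFin (suc n) ] (K * N)
  ≡⟨ sum-scale K (λ _ → N) (allFin (suc n)) ⟩
    K * ∑[ b ∈ allFin (suc n) ] N
  ≡⟨ cong (K *_) (sym (count-hasCat n K i (λ _ → true))) ⟩
    K * count (hasCat i ∩ᵇ (λ _ → true)) (Space (suc n) K)
  ≡⟨ cong (K *_) (count-cong (Space (suc n) K) (λ ω → ∧-identityʳ (hasCat i ω))) ⟩
    K * count (hasCat i) (Space (suc n) K)
  ∎
  where
  open ≡-Reasoning
  N = count (λ _ → true) (allFuns n K)

resampling : (m K : ℕ) (i : Fin K) (P Q : (Fin m → Fin K) × Fin m → Bool) →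
  (∀ c c' b → c b ≡ i → (∀ y → ¬ y ≡ b → c y ≡ c' y) → T (P (c , b)) → T (Q (c' , b))) →
  K * count (hasCat i ∩ᵇ P) (Space m K) ≤ count Q (Space m K)
resampling zero K i P Q P⇒Q = ≤-reflexive (*-zeroʳ K)
resampling (suc n) K i P Q P⇒Q = begin
    K * count (hasCat i ∩ᵇ P) (Space (suc n) K)
  ≡⟨ cong (K *_) (count-hasCat n K i P) ⟩
    K * ∑[ b ∈ allFin (suc n) ] ℓ b
  ≡⟨ sym (sum-scale K ℓ (allFin (suc n))) ⟩
    ∑[ b ∈ allFin (suc n) ] (K * ℓ b)
  ≡⟨ sum-cong (allFin (suc n)) (λ b → trans (cong (_* ℓ b) (sym (length-allFin K))) (sym (sum-const (ℓ b) (allFin K)))) ⟩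
    ∑[ b ∈ allFin (suc n) ] ∑[ x ∈ allFin K ] ℓ b
  ≤⟨ sum-mono (allFin (suc n)) (λ b → sum-mono (allFin K) (λ x → count-mono _ _ (allFuns n K) (λ g →
       P⇒Q (insertAt b i g) (insertAt b x g) b (insertAt-here b i g) (insertAt-elsewhere b i x g)))) ⟩
    ∑[ b ∈ allFin (suc n) ] ∑[ x ∈ allFin K ] count (λ g → Q (insertAt b x g , b)) (allFuns n K)
  ≡⟨ sym (count-Space n K Q) ⟩
    count Q (Space (suc n) K)
  ∎
  where
  open ≤-Reasoning
  ℓ : Fin (suc n) → ℕ
  ℓ b = count (λ g → P (insertAt b i g , b)) (allFuns n K)

=ᶠ-sound : {n : ℕ} {x y : Fin n} → T (x =ᶠ y) → x ≡ y
=ᶠ-sound {x = x} {y} t with x F.≟ y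
... | yes x≡y = x≡y
... | no _ = ⊥-elim t

=ᶠ-refl : {n : ℕ} (x : Fin n) → T (x =ᶠ x)
=ᶠ-refl x = subst T (sym (dec-true (x F.≟ x) refl)) tt

_≺[_]_ : {m K : ℕ} → Fin m → (Fin m → Fin K) → Fin m → Set
x ≺[ c ] y = toℕ (c x) < toℕ (c y) ⊎ (c x ≡ c y × toℕ x < toℕ y)

precedesᵇ : {m K : ℕ} → (Fin m → Fin K) → Fin m → Fin m → Bool
precedesᵇ c x y = (toℕ (c x) <ᵇ toℕ (c y)) ∨ ((c x =ᶠ c y) ∧ (toℕ x <ᵇ toℕ y))

module _ {m K : ℕ} (c : Fin m → Fin K) where

  precedesᵇ-sound : ∀ x y → T (precedesᵇ c x y) → x ≺[ c ] y
  precedesᵇ-sound x y t with Equivalence.to T-∨ t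
  ... | inj₁ cx<cy = inj₁ (<ᵇ⇒< _ _ cx<cy)
  ... | inj₂ t' with Equivalence.to T-∧ t'
  ... | (cx≡cy , x<y) = inj₂ (=ᶠ-sound cx≡cy , <ᵇ⇒< _ _ x<y)

  precedesᵇ-complete : ∀ x y → x ≺[ c ] y → T (precedesᵇ c x y)
  precedesᵇ-complete x y (inj₁ cx<cy) = Equivalence.from T-∨ (inj₁ (<⇒<ᵇ cx<cy))
  precedesᵇ-complete x y (inj₂ (cx≡cy , x<y)) =
    Equivalence.from T-∨ (inj₂ (Equivalence.from T-∧ (subst (λ z → T (c x =ᶠ z)) cx≡cy (=ᶠ-refl (c x)) , <⇒<ᵇ x<y)))

  ≺-trans : ∀ {x y z} → x ≺[ c ] y → y ≺[ c ] z → x ≺[ c ] z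
  ≺-trans (inj₁ a) (inj₁ b) = inj₁ (<-trans a b)
  ≺-trans {x} (inj₁ a) (inj₂ (e , _)) = inj₁ (subst (λ w → toℕ (c x) < toℕ w) e a)
  ≺-trans {z = z} (inj₂ (e , _)) (inj₁ b) = inj₁ (subst (λ w → toℕ w < toℕ (c z)) (sym e) b)
  ≺-trans (inj₂ (e , a)) (inj₂ (e' , b)) = inj₂ (trans e e' , <-trans a b)

  ≺-irrefl : ∀ {x} → ¬ x ≺[ c ] x
  ≺-irrefl (inj₁ a) = <-irrefl refl a
  ≺-irrefl (inj₂ (_ , a)) = <-irrefl refl a

  ≺-trichotomy : ∀ x y → x ≡ y ⊎ x ≺[ c ] y ⊎ y ≺[ c ] x
  ≺-trichotomy x y with <-cmp (toℕ (c x)) (toℕ (c y))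
  ... | tri< a _ _ = inj₂ (inj₁ (inj₁ a))
  ... | tri> _ _ a = inj₂ (inj₂ (inj₁ a))
  ... | tri≈ _ e _ with <-cmp (toℕ x) (toℕ y)
  ... | tri< a _ _ = inj₂ (inj₁ (inj₂ (toℕ-injective e , a)))
  ... | tri> _ _ a = inj₂ (inj₂ (inj₂ (toℕ-injective (sym e) , a)))
  ... | tri≈ _ e' _ = inj₁ (toℕ-injective e')

module _ {m : ℕ} (k : ℕ) (c : Cat m k) where

  -- x ≺ y makes every predecessor of x a predecessor of y, and x itself one more.
  σ-strict : ∀ x y → x ≺[ c ] y → σ k c x < σ k c y
  σ-strict x y x≺y = count-< (λ z → precedesᵇ c z x) (λ z → precedesᵇ c z y) (allFin m)
    (λ z z≺x → precedesᵇ-complete c z y (≺-trans c (precedesᵇ-sound c z x z≺x) x≺y))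
    x (∈-allFin x) (precedesᵇ-complete c x y x≺y) (≺-irrefl c ∘ precedesᵇ-sound c x x)

  σ-≤ : ∀ x y → σ k c x ≤ σ k c y → x ≡ y ⊎ x ≺[ c ] y
  σ-≤ x y σx≤σy with ≺-trichotomy c x y
  ... | inj₁ x≡y = inj₁ x≡y
  ... | inj₂ (inj₁ x≺y) = inj₂ x≺y
  ... | inj₂ (inj₂ y≺x) = ⊥-elim (<⇒≱ (σ-strict y x y≺x) σx≤σy)

  σ-injective : ∀ x y → σ k c x ≡ σ k c y → x ≡ y
  σ-injective x y σx≡σy with σ-≤ x y (≤-reflexive σx≡σy)
  ... | inj₁ x≡y = x≡y
  ... | inj₂ x≺y = ⊥-elim (<-irrefl σx≡σy (σ-strict x y x≺y))

  σ-category : ∀ x y → σ k c x ≤ σ k c y → toℕ (c x) ≤ toℕ (c y)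
  σ-category x y σx≤σy with σ-≤ x y σx≤σy
  ... | inj₁ refl = ≤-refl
  ... | inj₂ (inj₁ cx<cy) = <⇒≤ cx<cy
  ... | inj₂ (inj₂ (cx≡cy , _)) = ≤-reflexive (cong toℕ cx≡cy)

σ-resample : {m : ℕ} (k : ℕ) (c c' : Cat m k) (x y : Fin m) → c x ≡ c' x → c y ≡ c' y →
  σ k c x ≤ σ k c y → σ k c' x ≤ σ k c' y
σ-resample k c c' x y cx≡ cy≡ σx≤σy with σ-≤ k c x y σx≤σy
... | inj₁ refl = ≤-refl
... | inj₂ (inj₁ cx<cy) = <⇒≤ (σ-strict k c' x y (inj₁ (subst₂ (λ u v → toℕ u < toℕ v) cx≡ cy≡ cx<cy)))
... | inj₂ (inj₂ (cx≡cy , x<y)) = <⇒≤ (σ-strict k c' x y (inj₂ (trans (sym cx≡) (trans cx≡cy cy≡) , x<y)))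

module _ {X : Set} (p : X → Bool) where

  filterᵇ-sound : (L : List X) {x : X} → x ∈ filterᵇ p L → T (p x)
  filterᵇ-sound (y ∷ L) x∈ with p y in py | x∈
  ... | true | here refl = subst T (sym py) tt
  ... | true | there x∈' = filterᵇ-sound L x∈'
  ... | false | x∈' = filterᵇ-sound L x∈'

  filterᵇ-complete : (L : List X) {x : X} → x ∈ L → T (p x) → x ∈ filterᵇ p L
  filterᵇ-complete (y ∷ L) x∈ px with p y in py | x∈
  ... | true | here refl = here refl
  ... | true | there x∈' = there (filterᵇ-complete L x∈' px)
  ... | false | here refl = ⊥-elim (subst T py px)
  ... | false | there x∈' = filterᵇ-complete L x∈' px

  anyᵇ-witness : (L : List X) → T (anyᵇ p L) → Σ X (λ x → T (p x))
  anyᵇ-witness (x ∷ L) t with p x in px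
  ... | true = x , subst T (sym px) tt
  ... | false = anyᵇ-witness L t

  anyᵇ-intro : (L : List X) {x : X} → x ∈ L → T (p x) → T (anyᵇ p L)
  anyᵇ-intro (y ∷ L) x∈ px with p y in py | x∈
  ... | true | _ = tt
  ... | false | here refl = ⊥-elim (subst T py px)
  ... | false | there x∈' = anyᵇ-intro L x∈' px

isNothingᵇ-sound : {X : Set} (v : Maybe X) → T (isNothingᵇ v) → v ≡ nothing
isNothingᵇ-sound nothing _ = refl

isNothingᵇ-complete : {X : Set} {v : Maybe X} → v ≡ nothing → T (isNothingᵇ v)
isNothingᵇ-complete refl = tt

matchedTo-sound : {m : ℕ} (v : Maybe (Fin m)) (a : Fin m) → T (matchedTo v a) → v ≡ just a
matchedTo-sound (just a') a t = cong just (=ᶠ-sound t)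

just≢nothing : {X : Set} {x : X} → ¬ just x ≡ nothing
just≢nothing ()

pickMin-view : {m : ℕ} (r : Fin m → ℕ) (L : List (Fin m)) →
  (pickMin r L ≡ nothing × (∀ {x} → ¬ x ∈ L)) ⊎
  Σ (Fin m) (λ p → pickMin r L ≡ just p × p ∈ L × (∀ y → y ∈ L → r p ≤ r y))
pickMin-view r [] = inj₁ (refl , λ ())
pickMin-view r (b ∷ bs) with pickMin r bs | pickMin-view r bs
... | nothing | inj₁ (_ , bs-empty) =
  inj₂ (b , refl , here refl , λ { y (here refl) → ≤-refl ; y (there y∈) → ⊥-elim (bs-empty y∈) })
... | just p | inj₂ (p , refl , p∈ , p-min) with r b ≤ᵇ r p in rb≤rp
...   | true = inj₂ (b , refl , here refl , λ
          { y (here refl) → ≤-refl ; y (there y∈) → ≤-trans (≤ᵇ⇒≤ _ _ (subst T (sym rb≤rp) tt)) (p-min y y∈) })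
...   | false = inj₂ (p , refl , there p∈ , λ
          { y (here refl) → <⇒≤ (≰⇒> (λ rb≤rp' → subst T rb≤rp (≤⇒≤ᵇ rb≤rp'))) ; y (there y∈) → p-min y y∈ })

module _ {m : ℕ} (E : Graph m) where

  freeNbrs : Matching m → Fin m → List (Fin m)
  freeNbrs M a = filterᵇ (λ b → E a b ∧ isNothingᵇ (M b)) (allFin m)

  choice : (Fin m → ℕ) → Matching m → Fin m → Maybe (Fin m)
  choice r M a = pickMin r (freeNbrs M a)

  freeNbrs-sound : (M : Matching m) (a b : Fin m) → b ∈ freeNbrs M a → T (E a b) × M b ≡ nothing
  freeNbrs-sound M a b b∈ with Equivalence.to T-∧ (filterᵇ-sound (λ b → E a b ∧ isNothingᵇ (M b)) (allFin m) b∈)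
  ... | (Eab , free) = Eab , isNothingᵇ-sound (M b) free

  freeNbrs-complete : (M : Matching m) (a b : Fin m) → T (E a b) → M b ≡ nothing → b ∈ freeNbrs M a
  freeNbrs-complete M a b Eab free = filterᵇ-complete (λ b → E a b ∧ isNothingᵇ (M b)) (allFin m) (∈-allFin b)
    (Equivalence.from T-∧ (Eab , isNothingᵇ-complete free))

  step-view : (r : Fin m → ℕ) (M : Matching m) (a : Fin m) →
    (choice r M a ≡ nothing × (∀ y → step E r M a y ≡ M y)) ⊎
    Σ (Fin m) (λ p → choice r M a ≡ just p × (∀ y → step E r M a y ≡ (if y =ᶠ p then just a else M y)))
  step-view r M a with pickMin r (freeNbrs M a)
  ... | nothing = inj₁ (refl , λ y → refl)
  ... | just p = inj₂ (p , refl , λ y → refl)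

  module _ (r : Fin m → ℕ) (M : Matching m) (a : Fin m) where

    choice-free : ∀ p → choice r M a ≡ just p → T (E a p) × M p ≡ nothing
    choice-free p chosen with pickMin-view r (freeNbrs M a)
    ... | inj₁ (none , _) = ⊥-elim (just≢nothing (trans (sym chosen) none))
    ... | inj₂ (q , chosen' , q∈ , _) with just-injective (trans (sym chosen) chosen')
    ... | refl = freeNbrs-sound M a p q∈

    choice-minimal : ∀ p b → choice r M a ≡ just p → b ∈ freeNbrs M a → r p ≤ r b
    choice-minimal p b chosen b∈ with pickMin-view r (freeNbrs M a)
    ... | inj₁ (none , _) = ⊥-elim (just≢nothing (trans (sym chosen) none))
    ... | inj₂ (q , chosen' , _ , q-min) with just-injective (trans (sym chosen) chosen')
    ... | refl = q-min b b∈

    choice-exists : ∀ b → b ∈ freeNbrs M a → Σ (Fin m) (λ p → choice r M a ≡ just p)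
    choice-exists b b∈ with pickMin-view r (freeNbrs M a)
    ... | inj₁ (_ , empty) = ⊥-elim (empty b∈)
    ... | inj₂ (p , chosen , _) = p , chosen

    step-picks : ∀ p → choice r M a ≡ just p → step E r M a p ≡ just a
    step-picks p chosen with step-view r M a
    ... | inj₁ (none , _) = ⊥-elim (just≢nothing (trans (sym chosen) none))
    ... | inj₂ (p' , chosen' , upd) with just-injective (trans (sym chosen) chosen')
    ... | refl with p F.≟ p | upd p
    ...   | yes _ | step-p = step-p
    ...   | no p≢p | _ = ⊥-elim (p≢p refl)

    step-keeps : ∀ y z → M y ≡ just z → step E r M a y ≡ just z
    step-keeps y z My with step-view r M a
    ... | inj₁ (_ , same) = trans (same y) My
    ... | inj₂ (p , chosen , upd) with y F.≟ p | upd y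
    ...   | no _ | step-y = trans step-y My
    ...   | yes refl | _ = ⊥-elim (just≢nothing (trans (sym My) (proj₂ (choice-free y chosen))))

    step-free : ∀ y → step E r M a y ≡ nothing → M y ≡ nothing
    step-free y step-y with M y in My
    ... | nothing = refl
    ... | just z = ⊥-elim (just≢nothing (trans (sym (step-keeps y z My)) step-y))

    step-origin : ∀ y z → step E r M a y ≡ just z → M y ≡ just z ⊎ (z ≡ a × choice r M a ≡ just y)
    step-origin y z step-y with step-view r M a
    ... | inj₁ (_ , same) = inj₁ (trans (sym (same y)) step-y)
    ... | inj₂ (p , chosen , upd) with y F.≟ p | upd y
    ...   | no _ | step-y' = inj₁ (trans (sym step-y') step-y)
    ...   | yes refl | step-y' = inj₂ (just-injective (trans (sym step-y) step-y') , chosen)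

run-free : {m : ℕ} (E : Graph m) (r : Fin m → ℕ) (as : List (Fin m)) (M : Matching m) (y : Fin m) →
  foldl (step E r) M as y ≡ nothing → M y ≡ nothing
run-free E r [] M y free = free
run-free E r (a ∷ as) M y free = step-free E r M a y (run-free E r as (step E r M a) y free)

-- Comparison of two runs of Ranking, with rank functions r and r' that order all vertices other
-- than b₀ in the same way, while b₀ stays unmatched in the r-run.  Then every arriving vertex
-- matched in the r-run is matched in the r'-run to a vertex of no larger r'-rank.  This is the
-- monotonicity of Ranking on which the lemma rests: moving b₀ in the order cannot hurt the others.
module Comparison {m : ℕ} (E : Graph m) (r r' : Fin m → ℕ) (b₀ : Fin m)
  (same-order : ∀ x y → ¬ x ≡ b₀ → ¬ y ≡ b₀ → r x ≤ r y → r' x ≤ r' y)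
  (r'-injective : ∀ x y → r' x ≡ r' y → x ≡ y) where

  FreeIn : Matching m → Matching m → Set
  FreeIn M M' = ∀ y → ¬ y ≡ b₀ → M y ≡ nothing → M' y ≡ nothing

  Covers : Matching m → Matching m → Set
  Covers M M' = ∀ a p → M p ≡ just a → Σ (Fin m) (λ x → M' x ≡ just a × r' x ≤ r' p)

  module _ (M M' : Matching m) (a : Fin m) (free-in : FreeIn M M') (b₀-free : step E r M a b₀ ≡ nothing) where

    choice-avoids-b₀ : ∀ p → choice E r M a ≡ just p → ¬ p ≡ b₀
    choice-avoids-b₀ p chosen refl = just≢nothing (trans (sym (step-picks E r M a p chosen)) b₀-free)

    choice-available : ∀ p → choice E r M a ≡ just p → p ∈ freeNbrs E M' a
    choice-available p chosen = freeNbrs-complete E M' a p (proj₁ (choice-free E r M a p chosen))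
      (free-in p (choice-avoids-b₀ p chosen) (proj₂ (choice-free E r M a p chosen)))

    choice-follows : ∀ p → choice E r M a ≡ just p → Σ (Fin m) (λ x → choice E r' M' a ≡ just x × r' x ≤ r' p)
    choice-follows p chosen with choice-exists E r' M' a p (choice-available p chosen)
    ... | (x , chosen') = x , chosen' , choice-minimal E r' M' a x p chosen' (choice-available p chosen)

    choice-agrees : ∀ y → ¬ y ≡ b₀ → y ∈ freeNbrs E M a → choice E r' M' a ≡ just y → choice E r M a ≡ just y
    choice-agrees y y≢b₀ y∈ chosen' with choice-exists E r M a y y∈
    ... | (p , chosen) with choice-follows p chosen
    ... | (x , chosen'' , x≤p) with just-injective (trans (sym chosen') chosen'')
    ... | refl = subst (λ q → choice E r M a ≡ just q) p≡y chosen
      where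
      p≡y : p ≡ y
      p≡y = r'-injective p y (≤-antisym
        (same-order p y (choice-avoids-b₀ p chosen) y≢b₀ (choice-minimal E r M a p y chosen y∈)) x≤p)

    freeIn-step : FreeIn (step E r M a) (step E r' M' a)
    freeIn-step y y≢b₀ step-y with step-free E r M a y step-y | step E r' M' a y in step'-y
    ... | My | nothing = refl
    ... | My | just z with step-origin E r' M' a y z step'-y
    ...   | inj₁ M'y = ⊥-elim (just≢nothing (trans (sym M'y) (free-in y y≢b₀ My)))
    ...   | inj₂ (_ , chosen') = ⊥-elim (just≢nothing (trans (sym (step-picks E r M a y chosen)) step-y))
      where
      chosen : choice E r M a ≡ just y
      chosen = choice-agrees y y≢b₀ (freeNbrs-complete E M a y (proj₁ (choice-free E r' M' a y chosen')) My) chosen'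

    covers-step : Covers M M' → Covers (step E r M a) (step E r' M' a)
    covers-step covers a' p step-p with step-origin E r M a p a' step-p
    ... | inj₁ Mp with covers a' p Mp
    ...   | (x , M'x , x≤p) = x , step-keeps E r' M' a x a' M'x , x≤p
    covers-step covers a' p step-p | inj₂ (refl , chosen) with choice-follows p chosen
    ...   | (x , chosen' , x≤p) = x , step-picks E r' M' a x chosen' , x≤p

  simulate : (as : List (Fin m)) (M M' : Matching m) → foldl (step E r) M as b₀ ≡ nothing →
    FreeIn M M' → Covers M M' → Covers (foldl (step E r) M as) (foldl (step E r') M' as)
  simulate [] M M' b₀-free free-in covers = covers
  simulate (a ∷ as) M M' b₀-free free-in covers =
    simulate as (step E r M a) (step E r' M' a) b₀-free
      (freeIn-step M M' a free-in b₀-free-now) (covers-step M M' a free-in b₀-free-now covers)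
    where
    b₀-free-now : step E r M a b₀ ≡ nothing
    b₀-free-now = run-free E r as (step E r M a) b₀ b₀-free

  ranking-comparison : (ord : Fin m → Fin m) → Ranking E ord r b₀ ≡ nothing →
    ∀ a p → Ranking E ord r p ≡ just a → Σ (Fin m) (λ x → Ranking E ord r' x ≡ just a × r' x ≤ r' p)
  ranking-comparison ord b₀-free =
    simulate (map ord (allFin m)) (λ _ → nothing) (λ _ → nothing) b₀-free (λ _ _ _ → refl) (λ _ _ ())

module _ {m : ℕ} (k : ℕ) (M : Matching m) (c : Cat m k) (i : Fin (2 ^ k)) (a : Fin m) where

  matchedLow-sound : T (matchedLow k M c i a) → Σ (Fin m) (λ b' → M b' ≡ just a × toℕ (c b') ≤ toℕ i)
  matchedLow-sound low with anyᵇ-witness _ (allFin m) low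
  ... | (b' , b'-low) with Equivalence.to T-∧ b'-low
  ... | (matched , low') = b' , matchedTo-sound (M b') a matched , ≤ᵇ⇒≤ _ _ low'

  matchedLow-complete : ∀ b' → M b' ≡ just a → toℕ (c b') ≤ toℕ i → T (matchedLow k M c i a)
  matchedLow-complete b' matched low = anyᵇ-intro _ (allFin m) (∈-allFin b')
    (Equivalence.from T-∧ (subst (λ v → T (matchedTo v a)) (sym matched) (=ᶠ-refl a) , ≤⇒≤ᵇ low))

-- Changing c only at b keeps the σ-order of all other vertices, so Comparison applies to σ_c and σ_c'.
recategorised-ranking : {m : ℕ} (k : ℕ) (E : Graph m) (ord : Fin m → Fin m) (c c' : Cat m k) (b : Fin m) →
  (∀ y → ¬ y ≡ b → c y ≡ c' y) → Mc k E ord c b ≡ nothing →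
  ∀ a p → Mc k E ord c p ≡ just a → Σ (Fin m) (λ x → Mc k E ord c' x ≡ just a × σ k c' x ≤ σ k c' p)
recategorised-ranking k E ord c c' b agree =
  Comparison.ranking-comparison E (σ k c) (σ k c') b same-order (σ-injective k c') ord
  where
  same-order : ∀ x y → ¬ x ≡ b → ¬ y ≡ b → σ k c x ≤ σ k c y → σ k c' x ≤ σ k c' y
  same-order x y x≢b y≢b = σ-resample k c c' x y (agree x x≢b) (agree y y≢b)

recategorise : {m : ℕ} (k : ℕ) (E : Graph m) (ord Mstar : Fin m → Fin m) (i : Fin (2 ^ k)) (c c' : Cat m k) (b : Fin m) →
  (∀ y → ¬ y ≡ b → c y ≡ c' y) → T (evLeft k E ord Mstar i (c , b)) → T (evRight k E ord Mstar i (c' , b))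
recategorise k E ord Mstar i c c' b agree left with Equivalence.to T-∧ left
... | (b-free , low) with matchedLow-sound k (Mc k E ord c) c i (Mstar b) low
... | (b' , matched , cb'≤i) with recategorised-ranking k E ord c c' b agree b-unmatched (Mstar b) b' matched
  where
  b-unmatched : Mc k E ord c b ≡ nothing
  b-unmatched = isNothingᵇ-sound (Mc k E ord c b) b-free
... | (b'' , matched' , σb''≤σb') = matchedLow-complete k (Mc k E ord c') c' i (Mstar b) b'' matched'
  (≤-trans (σ-category k c' b'' b' σb''≤σb') (subst (λ z → toℕ z ≤ toℕ i) (agree b' b'≢b) cb'≤i))
  where
  b'≢b : ¬ b' ≡ b
  b'≢b refl = just≢nothing (trans (sym matched) (isNothingᵇ-sound (Mc k E ord c b') b-free))

-- Lemma 16: Pr[b ∉ V(M) ∧ M*(b) matched to category ≤ i | c(b) = i] ≤ Pr[M*(b) matched to category ≤ i],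
-- in the cleared form #(C ∩ L) · |Ω| ≤ #R · #C.  Since |Ω| = 2^k · #C, this is 2^k · #(C ∩ L) ≤ #R,
-- which is resampling applied to the pointwise lemma.
lemma16 : (m k : ℕ) → 1 ≤ k → (E : Graph m) → (Mstar : Fin m → Fin m) → Injective _≡_ _≡_ Mstar → (∀ b → T (E (Mstar b) b)) → (ord : Fin m → Fin m) → Injective _≡_ _≡_ ord → (i : Fin (2 ^ k)) →
    count (evCat k i ∩ᵇ evLeft k E ord Mstar i) (Ω m k) * length (Ω m k)
    ≤ count (evRight k E ord Mstar i) (Ω m k) * count (evCat k i) (Ω m k)
lemma16 m k _ E Mstar _ _ ord _ i = begin
    CL * length (Ω m k)
  ≡⟨ cong (CL *_) (length-Space m K i) ⟩
    CL * (K * C)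
  ≡⟨ trans (sym (*-assoc CL K C)) (cong (_* C) (*-comm CL K)) ⟩
    K * CL * C
  ≤⟨ *-monoˡ-≤ C (resampling m K i (evLeft k E ord Mstar i) (evRight k E ord Mstar i)
       (λ c c' b _ → recategorise k E ord Mstar i c c' b)) ⟩
    count (evRight k E ord Mstar i) (Ω m k) * C
  ∎
  where
  open ≤-Reasoning
  K = 2 ^ k
  C = count (evCat k i) (Ω m k)
  CL = count (evCat k i ∩ᵇ evLeft k E ord Mstar i) (Ω m k)
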